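{- For every $\mathrm{S2S}+\forall^{\ast}_{\pi}$ formula $\phi$ one can effectively construct a semantically equivalent $\mathrm{S2S}$ formula $\psi$.
   Context: $\mathrm{S2S}$ is monadic second-order logic of the full binary tree $(\{\mathtt{L},\mathtt{R}\}^\ast,\mathrm{succ}_L,\mathrm{succ}_R)$ with $\mathrm{succ}_L=\{(w,w\mathtt{L})\}$, $\mathrm{succ}_R=\{(w,w\mathtt{R})\}$: formulas are built from atoms $\mathrm{succ}_L(x,y)$, $\mathrm{succ}_R(x,y)$, $x\in X$ using $\neg,\vee$, first-order quantification over vertices and second-order quantification over sets of vertices; a formula with free second-order variables $Y_1,\dots,Y_n$ defines the set of tuples of subsets of $\{\mathtt{L},\mathtt{R}\}^\ast$ satisfying it, and two formulas are semantically equivalent if they define the same set. A path is a set $X\subseteq\{\mathtt{L},\mathtt{R}\}^\ast$ containing the empty word, closed under prefixes, and such that each $v\in X$ has exactly one of $v\mathtt{L},v\mathtt{R}$ in $X$; the set $\mathcal{P}$ of paths is identified with $\{\mathtt{L},\mathtt{R}\}^\omega$ and given its product (Cantor) topology. $\mathrm{S2S}+\forall^{\ast}_{\pi}$ adds the quantifier $\forall^{\ast}_\pi X.\,\phi$: a tuple $t$ satisfies $\forall^{\ast}_\pi X.\,\phi(X,Y_1,\dots,Y_n)$ iff the set $\{p\in\mathcal{P}\mid (p,t)\text{ satisfies }\phi\}$ is comeager in $\mathcal{P}$. -}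

module Defs where

open import Data.Nat using (ℕ; zero; suc)
open import Data.Fin using (Fin; zero; suc)
open import Data.Bool using (Bool; true; false; _∧_)
open import Data.List using (List; []; _∷_; _++_; [_])
open import Data.Product using (Σ; _×_; _,_)
open import Data.Sum using (_⊎_)
open import Data.Empty using (⊥)
open import Relation.Binary.PropositionalEquality using (_≡_)
open import Relation.Nullary using (¬_)
open import Function.Bundles using (_⇔_)

data Dir : Set where
  L R : Dir

_==ᴰ_ : Dir → Dir → Bool
L ==ᴰ L = true
R ==ᴰ R = true
L ==ᴰ R = false
R ==ᴰ L = false

Word : Set
Word = List Dir

VSet : Set
VSet = Word → Bool

-- Paths, identified with {L,R}^ω (Cantor space)

Path : Set
Path = ℕ → Dir

prefixOf : Word → Path → Bool
prefixOf []      p = true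
prefixOf (d ∷ w) p = (d ==ᴰ p zero) ∧ prefixOf w (λ i → p (suc i))

pathSet : Path → VSet
pathSet p w = prefixOf w p

-- Topology of Cantor space.
-- The open set generated by a set O of words: all paths having a prefix in O.
OpenOf : VSet → Path → Set
OpenOf O p = Σ Word (λ w → (prefixOf w p ≡ true) × (O w ≡ true))

Dense : (Path → Set) → Set
Dense U = (w : Word) → Σ Path (λ p → (prefixOf w p ≡ true) × U p)

Comeager : (Path → Set) → Set
Comeager S =
  Σ (ℕ → VSet) (λ O →
    ((n : ℕ) → Dense (OpenOf (O n))) ×
    ((p : Path) → ((n : ℕ) → OpenOf (O n) p) → S p))

-- Syntax (intrinsically scoped de Bruijn):
-- m = number of first-order variables in scope, n = second-order.

data Fm (m n : ℕ) : Set where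
  succL succR : Fin m → Fin m → Fm m n
  mem   : Fin m → Fin n → Fm m n
  neg   : Fm m n → Fm m n
  or    : Fm m n → Fm m n → Fm m n
  ex₁   : Fm (suc m) n → Fm m n
  ex₂   : Fm m (suc n) → Fm m n

data Fm⁺ (m n : ℕ) : Set where
  succL succR : Fin m → Fin m → Fm⁺ m n
  mem   : Fin m → Fin n → Fm⁺ m n
  neg   : Fm⁺ m n → Fm⁺ m n
  or    : Fm⁺ m n → Fm⁺ m n → Fm⁺ m n
  ex₁   : Fm⁺ (suc m) n → Fm⁺ m n
  ex₂   : Fm⁺ m (suc n) → Fm⁺ m n
  allπ  : Fm⁺ m (suc n) → Fm⁺ m n

_∷ᵛ_ : {A : Set} {k : ℕ} → A → (Fin k → A) → Fin (suc k) → A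
(a ∷ᵛ ρ) zero    = a
(a ∷ᵛ ρ) (suc i) = ρ i

⟦_⟧ : {m n : ℕ} → Fm m n → (Fin m → Word) → (Fin n → VSet) → Set
⟦ succL x y ⟧ ρ σ = ρ y ≡ ρ x ++ [ L ]
⟦ succR x y ⟧ ρ σ = ρ y ≡ ρ x ++ [ R ]
⟦ mem x X   ⟧ ρ σ = σ X (ρ x) ≡ true
⟦ neg φ     ⟧ ρ σ = ¬ ⟦ φ ⟧ ρ σ
⟦ or φ ψ    ⟧ ρ σ = ⟦ φ ⟧ ρ σ ⊎ ⟦ ψ ⟧ ρ σ
⟦ ex₁ φ     ⟧ ρ σ = Σ Word (λ w → ⟦ φ ⟧ (w ∷ᵛ ρ) σ)
⟦ ex₂ φ     ⟧ ρ σ = Σ VSet (λ X → ⟦ φ ⟧ ρ (X ∷ᵛ σ))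

⟦_⟧⁺ : {m n : ℕ} → Fm⁺ m n → (Fin m → Word) → (Fin n → VSet) → Set
⟦ succL x y ⟧⁺ ρ σ = ρ y ≡ ρ x ++ [ L ]
⟦ succR x y ⟧⁺ ρ σ = ρ y ≡ ρ x ++ [ R ]
⟦ mem x X   ⟧⁺ ρ σ = σ X (ρ x) ≡ true
⟦ neg φ     ⟧⁺ ρ σ = ¬ ⟦ φ ⟧⁺ ρ σ
⟦ or φ ψ    ⟧⁺ ρ σ = ⟦ φ ⟧⁺ ρ σ ⊎ ⟦ ψ ⟧⁺ ρ σ
⟦ ex₁ φ     ⟧⁺ ρ σ = Σ Word (λ w → ⟦ φ ⟧⁺ (w ∷ᵛ ρ) σ)
⟦ ex₂ φ     ⟧⁺ ρ σ = Σ VSet (λ X → ⟦ φ ⟧⁺ ρ (X ∷ᵛ σ))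
⟦ allπ φ    ⟧⁺ ρ σ = Comeager (λ p → ⟦ φ ⟧⁺ ρ (pathSet p ∷ᵛ σ))

noFO : Fin zero → Word
noFO ()

Equivalent : {n : ℕ} → Fm⁺ zero n → Fm zero n → Set
Equivalent {n} φ ψ = (σ : Fin n → VSet) → ⟦ φ ⟧⁺ noFO σ ⇔ ⟦ ψ ⟧ noFO σ

module Submission where

-- Key fact (Comeager⇔DenseWitness): if a property P of vertex sets respects
-- pointwise equality, then P holds of comeager-many paths iff some dense set
-- Z of vertices has P hold of every path meeting Z infinitely often.
--   (⇐) the paths with more than n vertices in Z form dense open sets;
--   (⇒) from dense open sets O n choose Z so that a vertex is chosen when it
--       extends a generator of O k, k counting the chosen vertices above it;
--       a path meeting Z infinitely often then lies in every O n.
-- Density, "X is a path" and "X meets Z infinitely often" are S2S-definable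
-- (the prefix order being the least child-closed relation), so ∀*_π X. φ can
-- be translated to ∃Z. dense(Z) ∧ ∀X. (path(X) ∧ meets(X, Z) → φ).  The
-- translation is constructive; its correctness is classical, because ∧, →
-- and ∀ are encoded through ¬, ∨ and ∃.

open import Defs
open import Data.Nat using (ℕ; zero; suc; _+_; _≤_; _<_; _<ᵇ_; z≤n; s≤s)
open import Data.Nat.Properties
  using (≤-refl; ≤-trans; <-irrefl; <⇒≱; m≤m+n; m≤n+m; m<m+n; +-monoʳ-≤; +-monoʳ-<;
         +-cancelˡ-<; +-identityʳ; +-suc; +-comm; <⇒<ᵇ; <ᵇ⇒<)
open import Data.Fin using (Fin; zero; suc)
open import Data.Bool using (Bool; true; false; _∧_; _∨_; if_then_else_)
open import Data.Bool.Properties using (∧-conicalˡ; ∧-conicalʳ; T-≡)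
open import Data.List using ([]; _∷_; _++_; [_]; length)
open import Data.List.Properties using (++-assoc; ++-identityʳ; length-++)
open import Data.List.Reverse using (Reverse; reverseView; []; _∶_∶ʳ_)
open import Data.Product using (Σ; _×_; _,_)
open import Data.Sum using (_⊎_; inj₁; inj₂)
open import Data.Sum.Function.Propositional using (_⊎-⇔_)
open import Data.Empty using (⊥-elim)
open import Function using (id)
open import Function.Bundles using (_⇔_; mk⇔; Equivalence)
open import Function.Properties.Equivalence using ()
  renaming (refl to ⇔-refl; sym to ⇔-sym; trans to ⇔-trans)
open import Function.Related.TypeIsomorphisms using (¬-cong-⇔)
open import Relation.Binary.PropositionalEquality
  using (_≡_; refl; sym; trans; cong; cong₂; subst; module ≡-Reasoning)
open import Relation.Nullary using (¬_; yes; no)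
open import Level using (0ℓ)
open import Axiom.ExcludedMiddle using (ExcludedMiddle)
open import Axiom.DoubleNegationElimination using (em⇒dne)

open Equivalence using (to; from)

∧-intro : ∀ {a b} → a ≡ true → b ≡ true → (a ∧ b) ≡ true
∧-intro refl refl = refl

∨-introʳ : ∀ a {b} → b ≡ true → (a ∨ b) ≡ true
∨-introʳ true  _ = refl
∨-introʳ false e = e

true-iff : ∀ {a b : Bool} → (a ≡ true → b ≡ true) → (b ≡ true → a ≡ true) → a ≡ b
true-iff {true}  {true}  _ _ = refl
true-iff {false} {false} _ _ = refl
true-iff {true}  {false} f _ = sym (f refl)
true-iff {false} {true}  _ g = g refl

==ᴰ-sound : ∀ {d e} → (d ==ᴰ e) ≡ true → d ≡ e
==ᴰ-sound {L} {L} _ = refl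
==ᴰ-sound {R} {R} _ = refl
==ᴰ-sound {L} {R} ()
==ᴰ-sound {R} {L} ()

==ᴰ-refl : ∀ d → (d ==ᴰ d) ≡ true
==ᴰ-refl L = refl
==ᴰ-refl R = refl

_≼_ : Word → Word → Set
u ≼ v = Σ Word λ s → v ≡ u ++ s

_≺_ : Word → Word → Set
u ≺ v = Σ Dir λ d → Σ Word λ s → v ≡ u ++ d ∷ s

Child : Word → Word → Set
Child u v = Σ Dir λ d → v ≡ u ++ [ d ]

child⇔ : ∀ u v → ((v ≡ u ++ [ L ]) ⊎ (v ≡ u ++ [ R ])) ⇔ Child u v
child⇔ u v = mk⇔ (λ { (inj₁ e) → L , e ; (inj₂ e) → R , e })
                 (λ { (L , e) → inj₁ e ; (R , e) → inj₂ e })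

child-then-prefix⇔≺ : ∀ u v → (Σ Word λ y → Child u y × y ≼ v) ⇔ (u ≺ v)
child-then-prefix⇔≺ u v = mk⇔
  (λ { (_ , (d , refl) , (s , refl)) → d , s , ++-assoc u [ d ] s })
  (λ { (d , s , refl) → u ++ [ d ] , (d , refl) , (s , sym (++-assoc u [ d ] s)) })

length-snoc : ∀ w (d : Dir) → length (w ++ [ d ]) ≡ suc (length w)
length-snoc w d = trans (length-++ w) (+-comm (length w) 1)

snoc-induction : (P : Word → Set) → P [] → (∀ w d → P w → P (w ++ [ d ])) → ∀ w → P w
snoc-induction P base step w = go w (reverseView w)
  where
  go : ∀ w → Reverse w → P w
  go .[] [] = base
  go .(w ++ [ d ]) (w ∶ r ∶ʳ d) = step w d (go w r)

below : Dir → VSet → VSet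
below d Y w = Y (d ∷ w)

Upward : VSet → Set
Upward Y = ∀ {u v} → u ≼ v → Y u ≡ true → Y v ≡ true

below-upward : ∀ d {Y} → Upward Y → Upward (below d Y)
below-upward d up (s , refl) = up (s , refl)

ChildClosed : VSet → Set
ChildClosed Y = ∀ a d → Y a ≡ true → Y (a ++ [ d ]) ≡ true

childClosed⇒upward : ∀ {Y} → ChildClosed Y → Upward Y
childClosed⇒upward {Y} closed {u} (s , refl) yu = descend s
  where
  descend : ∀ s → Y (u ++ s) ≡ true
  descend = snoc-induction (λ s → Y (u ++ s) ≡ true)
    (subst (λ v → Y v ≡ true) (sym (++-identityʳ u)) yu)
    (λ s d ys → subst (λ v → Y v ≡ true) (++-assoc u s [ d ]) (closed (u ++ s) d ys))

isPrefix : Word → VSet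
isPrefix []      v       = true
isPrefix (d ∷ u) []      = false
isPrefix (d ∷ u) (e ∷ v) = (d ==ᴰ e) ∧ isPrefix u v

isPrefix-refl : ∀ u → isPrefix u u ≡ true
isPrefix-refl []      = refl
isPrefix-refl (d ∷ u) = ∧-intro (==ᴰ-refl d) (isPrefix-refl u)

isPrefix-closed : ∀ u → ChildClosed (isPrefix u)
isPrefix-closed []      a       d _ = refl
isPrefix-closed (x ∷ u) []      d ()
isPrefix-closed (x ∷ u) (y ∷ a) d e =
  ∧-intro (∧-conicalˡ _ _ e) (isPrefix-closed u a d (∧-conicalʳ (x ==ᴰ y) _ e))

isPrefix-sound : ∀ u v → isPrefix u v ≡ true → u ≼ v
isPrefix-sound []      v       _ = v , refl
isPrefix-sound (x ∷ u) []      ()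
isPrefix-sound (x ∷ u) (y ∷ v) e
  with ==ᴰ-sound {x} {y} (∧-conicalˡ _ _ e) | isPrefix-sound u v (∧-conicalʳ (x ==ᴰ y) _ e)
... | refl | s , refl = s , refl

-- The prefix order is the least child-closed relation (this makes it MSO-definable).
≼⇔closure : ∀ u v → ((Y : VSet) → Y u ≡ true → ChildClosed Y → Y v ≡ true) ⇔ (u ≼ v)
≼⇔closure u v = mk⇔
  (λ h → isPrefix-sound u v (h (isPrefix u) (isPrefix-refl u) (isPrefix-closed u)))
  (λ u≼v Y yu closed → childClosed⇒upward closed u≼v yu)

tail : Path → Path
tail p i = p (suc i)

initial : ℕ → Path → Word
initial zero    p = []
initial (suc n) p = p zero ∷ initial n (tail p)

initial-suc : ∀ n p → initial (suc n) p ≡ initial n p ++ [ p n ]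
initial-suc zero    p = refl
initial-suc (suc n) p = cong (p zero ∷_) (initial-suc n (tail p))

initial-prefixOf : ∀ n p → prefixOf (initial n p) p ≡ true
initial-prefixOf zero    p = refl
initial-prefixOf (suc n) p = ∧-intro (==ᴰ-refl (p zero)) (initial-prefixOf n (tail p))

prefixOf→initial : ∀ w p → prefixOf w p ≡ true → w ≡ initial (length w) p
prefixOf→initial []      p e = refl
prefixOf→initial (d ∷ w) p e =
  cong₂ _∷_ (==ᴰ-sound (∧-conicalˡ _ _ e)) (prefixOf→initial w (tail p) (∧-conicalʳ (d ==ᴰ p zero) _ e))

prefixOf-≼ : ∀ {u v} p → u ≼ v → prefixOf v p ≡ true → prefixOf u p ≡ true
prefixOf-≼ {[]}    p _        _ = refl
prefixOf-≼ {d ∷ u} p (s , refl) e =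
  ∧-intro (∧-conicalˡ _ _ e) (prefixOf-≼ {u} (tail p) (s , refl) (∧-conicalʳ (d ==ᴰ p zero) _ e))

prefixOf-comparable : ∀ u v p → prefixOf u p ≡ true → prefixOf v p ≡ true → u ≼ v ⊎ v ≼ u
prefixOf-comparable []      v       p _ _ = inj₁ (v , refl)
prefixOf-comparable (x ∷ u) []      p _ _ = inj₂ (x ∷ u , refl)
prefixOf-comparable (x ∷ u) (y ∷ v) p pu pv
  with ==ᴰ-sound {x} {p zero} (∧-conicalˡ _ _ pu) | ==ᴰ-sound {y} {p zero} (∧-conicalˡ _ _ pv)
... | refl | refl
  with prefixOf-comparable u v (tail p) (∧-conicalʳ (x ==ᴰ p zero) _ pu) (∧-conicalʳ (y ==ᴰ p zero) _ pv)
...   | inj₁ (s , refl) = inj₁ (s , refl)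
...   | inj₂ (s , refl) = inj₂ (s , refl)

prefixOf-snoc : ∀ w d p → prefixOf w p ≡ true → prefixOf (w ++ [ d ]) p ≡ (d ==ᴰ p (length w))
prefixOf-snoc []      d p _ with d ==ᴰ p zero
... | true  = refl
... | false = refl
prefixOf-snoc (x ∷ w) d p e with x ==ᴰ p zero
... | true = prefixOf-snoc w d (tail p) e

pathThrough : Word → Path
pathThrough []      n       = L
pathThrough (d ∷ v) zero    = d
pathThrough (d ∷ v) (suc n) = pathThrough v n

prefixOf-pathThrough : ∀ {u v} → u ≼ v → prefixOf u (pathThrough v) ≡ true
prefixOf-pathThrough {[]}    _          = refl
prefixOf-pathThrough {d ∷ u} (s , refl) = ∧-intro (==ᴰ-refl d) (prefixOf-pathThrough {u} (s , refl))

ParentClosed : VSet → Set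
ParentClosed X = ∀ a d → X (a ++ [ d ]) ≡ true → X a ≡ true

OneChild : VSet → Set
OneChild X = ∀ x → X x ≡ true →
  (X (x ++ [ L ]) ≡ true × ¬ X (x ++ [ R ]) ≡ true) ⊎ (¬ X (x ++ [ L ]) ≡ true × X (x ++ [ R ]) ≡ true)

record IsPath (X : VSet) : Set where
  field
    nonempty     : Σ Word λ w → X w ≡ true
    parentClosed : ParentClosed X
    oneChild     : OneChild X

pathSet-isPath : ∀ p → IsPath (pathSet p)
pathSet-isPath p = record
  { nonempty     = [] , refl
  ; parentClosed = λ a d → prefixOf-≼ {a} p ([ d ] , refl)
  ; oneChild     = oneChild
  }
  where
  oneChild : ∀ x → prefixOf x p ≡ true →
    (prefixOf (x ++ [ L ]) p ≡ true × ¬ prefixOf (x ++ [ R ]) p ≡ true) ⊎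
    (¬ prefixOf (x ++ [ L ]) p ≡ true × prefixOf (x ++ [ R ]) p ≡ true)
  oneChild x e rewrite prefixOf-snoc x L p e | prefixOf-snoc x R p e with p (length x)
  ... | L = inj₁ (refl , λ ())
  ... | R = inj₂ ((λ ()) , refl)

-- Conversely every path-set X is the set of prefixes of an infinite word:
-- starting at the root, follow the unique child that lies in X.
module PathOfSet (X : VSet) (isPath : IsPath X) where
  open IsPath isPath

  prefix-closed : ∀ {u v} → u ≼ v → X v ≡ true → X u ≡ true
  prefix-closed {u} (s , refl) = ascend s
    where
    ascend : ∀ s → X (u ++ s) ≡ true → X u ≡ true
    ascend = snoc-induction (λ s → X (u ++ s) ≡ true → X u ≡ true)
      (subst (λ v → X v ≡ true) (++-identityʳ u))
      (λ s d ih xs → ih (parentClosed (u ++ s) d (subst (λ v → X v ≡ true) (sym (++-assoc u s [ d ])) xs)))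

  root : X [] ≡ true
  root = let (w , xw) = nonempty in prefix-closed (w , refl) xw

  node : ℕ → Word
  direction : Path
  node zero    = []
  node (suc n) = node n ++ [ direction n ]
  direction n  = if X (node n ++ [ L ]) then L else R

  node∈X : ∀ n → X (node n) ≡ true
  node∈X zero = root
  node∈X (suc n) with X (node n ++ [ L ]) in inL | oneChild (node n) (node∈X n)
  ... | true  | _              = inL
  ... | false | inj₁ (() , _)
  ... | false | inj₂ (_ , inR) = inR

  child-direction : ∀ n d → X (node n ++ [ d ]) ≡ true → d ≡ direction n
  child-direction n L e rewrite e = refl
  child-direction n R e with X (node n ++ [ L ]) in inL | oneChild (node n) (node∈X n)
  ... | false | _                 = refl
  ... | true  | inj₁ (_ , notR)   = ⊥-elim (notR e)
  ... | true  | inj₂ (notL , _)   = ⊥-elim (notL refl)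

  node≡initial : ∀ n → node n ≡ initial n direction
  node≡initial zero    = refl
  node≡initial (suc n) =
    trans (cong (_++ [ direction n ]) (node≡initial n)) (sym (initial-suc n direction))

  member-is-node : ∀ w → X w ≡ true → w ≡ node (length w)
  member-is-node = snoc-induction (λ w → X w ≡ true → w ≡ node (length w)) (λ _ → refl) step
    where
    open ≡-Reasoning
    step : ∀ w d → (X w ≡ true → w ≡ node (length w)) →
           X (w ++ [ d ]) ≡ true → w ++ [ d ] ≡ node (length (w ++ [ d ]))
    step w d ih e =
      begin
        w ++ [ d ]                                  ≡⟨ cong₂ (λ v c → v ++ [ c ]) w≡node d≡direction ⟩
        node (length w) ++ [ direction (length w) ] ≡⟨ cong node (sym (length-snoc w d)) ⟩
        node (length (w ++ [ d ]))                  ∎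
      where
      w≡node : w ≡ node (length w)
      w≡node = ih (parentClosed w d e)
      d≡direction : d ≡ direction (length w)
      d≡direction = child-direction (length w) d (subst (λ v → X (v ++ [ d ]) ≡ true) w≡node e)

  pathSet-direction : ∀ w → pathSet direction w ≡ X w
  pathSet-direction w = true-iff onPath inX
    where
    onPath : prefixOf w direction ≡ true → X w ≡ true
    onPath e = subst (λ v → X v ≡ true)
      (sym (trans (prefixOf→initial w direction e) (sym (node≡initial (length w)))))
      (node∈X (length w))
    inX : X w ≡ true → prefixOf w direction ≡ true
    inX e = subst (λ v → prefixOf v direction ≡ true)
      (sym (trans (member-is-node w e) (node≡initial (length w))))
      (initial-prefixOf (length w) direction)

indicator : Bool → ℕ
indicator true  = 1
indicator false = 0

-- hits Z w : the number of prefixes of w (including [] and w itself) in Z.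
hits : VSet → Word → ℕ
hits Z []      = indicator (Z [])
hits Z (d ∷ w) = indicator (Z []) + hits (below d Z) w

hits-last : ∀ Z w → indicator (Z w) ≤ hits Z w
hits-last Z []      = ≤-refl
hits-last Z (d ∷ w) = ≤-trans (hits-last (below d Z) w) (m≤n+m _ (indicator (Z [])))

hits-mono : ∀ Z {u v} → u ≼ v → hits Z u ≤ hits Z v
hits-mono Z {[]}    ([] , refl)    = ≤-refl
hits-mono Z {[]}    (d ∷ s , refl) = m≤m+n _ _
hits-mono Z {c ∷ u} (s , refl)     = +-monoʳ-≤ (indicator (Z [])) (hits-mono (below c Z) {u} (s , refl))

hits-strict : ∀ Z {u v} → u ≺ v → Z v ≡ true → hits Z u < hits Z v
hits-strict Z {[]} (d , s , refl) z =
  m<m+n (indicator (Z [])) (subst (λ b → indicator b ≤ hits (below d Z) s) z (hits-last (below d Z) s))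
hits-strict Z {c ∷ u} (d , s , refl) z =
  +-monoʳ-< (indicator (Z [])) (hits-strict (below c Z) {u} (d , s , refl) z)

hits-positive : ∀ Z w → 0 < hits Z w → Σ Word λ t → t ≼ w × Z t ≡ true
hits-positive Z [] lt with Z [] in z
... | true = [] , ([] , refl) , z
hits-positive Z [] () | false
hits-positive Z (d ∷ w) lt with Z [] in z
... | true  = [] , (d ∷ w , refl) , z
... | false with hits-positive (below d Z) w lt
...   | t , (r , refl) , zt = d ∷ t , (r , refl) , zt

hits-increase : ∀ Z u s → hits Z u < hits Z (u ++ s) →
  Σ Word λ t → u ≺ t × t ≼ (u ++ s) × Z t ≡ true
hits-increase Z [] [] lt = ⊥-elim (<-irrefl refl lt)
hits-increase Z [] (e ∷ s) lt =
  let (t , (r , s≡) , zt) = hits-positive (below e Z) s positive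
  in e ∷ t , (e , t , refl) , (r , cong (e ∷_) s≡) , zt
  where
  b : ℕ
  b = indicator (Z [])
  positive : 0 < hits (below e Z) s
  positive = +-cancelˡ-< b 0 _ (subst (_< b + hits (below e Z) s) (sym (+-identityʳ b)) lt)
hits-increase Z (c ∷ u) s lt with hits-increase (below c Z) u s (+-cancelˡ-< (indicator (Z [])) _ _ lt)
... | t , (d , r , t≡) , (q , s≡) , zt = c ∷ t , (d , r , cong (c ∷_) t≡) , (q , cong (c ∷_) s≡) , zt

DenseSet : VSet → Set
DenseSet Z = ∀ u → Σ Word λ s → Z (u ++ s) ≡ true

-- Every vertex of X has a proper descendant in X ∩ Z; for a path X this
-- says that X meets Z infinitely often.
MeetsInfinitelyOften : VSet → VSet → Set
MeetsInfinitelyOften X Z = ∀ u → X u ≡ true → Σ Word λ v → u ≺ v × X v ≡ true × Z v ≡ true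

DenseWitness : (VSet → Set) → Set
DenseWitness P = Σ VSet λ Z → DenseSet Z × (∀ X → IsPath X → MeetsInfinitelyOften X Z → P X)

RespectsPointwise : (VSet → Set) → Set
RespectsPointwise P = ∀ X X' → (∀ w → X w ≡ X' w) → P X → P X'

many-hits : ∀ {X Z u} → MeetsInfinitelyOften X Z → X u ≡ true →
  ∀ n → Σ Word λ w → X w ≡ true × n ≤ hits Z w
many-hits {u = u} meets xu zero = u , xu , z≤n
many-hits {Z = Z} meets xu (suc n) =
  let (w , xw , n≤) = many-hits meets xu n
      (v , w≺v , xv , zv) = meets w xw
  in v , xv , ≤-trans (s≤s n≤) (hits-strict Z w≺v zv)

-- The upward closure ↑ Y: vertices having a prefix in Y.  The open set of
-- paths generated by Y consists of the paths through ↑ Y.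

↑ : VSet → VSet
↑ Y []      = Y []
↑ Y (d ∷ w) = Y [] ∨ ↑ (below d Y) w

↑-incl : ∀ Y w → Y w ≡ true → ↑ Y w ≡ true
↑-incl Y []      e = e
↑-incl Y (d ∷ w) e = ∨-introʳ (Y []) (↑-incl (below d Y) w e)

↑-root : ∀ Y w → Y [] ≡ true → ↑ Y w ≡ true
↑-root Y []      e = e
↑-root Y (d ∷ w) e rewrite e = refl

↑-upward : ∀ Y → Upward (↑ Y)
↑-upward Y {[]}    (s , refl) e = ↑-root Y s e
↑-upward Y {d ∷ u} (s , refl) e with Y []
... | true  = refl
... | false = ↑-upward (below d Y) {u} (s , refl) e

↑-sound : ∀ Y w → ↑ Y w ≡ true → Σ Word λ v → v ≼ w × Y v ≡ true
↑-sound Y []      e = [] , ([] , refl) , e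
↑-sound Y (d ∷ w) e with Y [] in y
... | true  = [] , (d ∷ w , refl) , y
... | false with ↑-sound (below d Y) w e
...   | v , (s , refl) , yv = d ∷ v , (s , refl) , yv

↑-open : ∀ Y {w} p → ↑ Y w ≡ true → prefixOf w p ≡ true → OpenOf Y p
↑-open Y {w} p e onW = let (v , v≼w , yv) = ↑-sound Y w e in v , prefixOf-≼ p v≼w onW , yv

↑-dense : ∀ Y → Dense (OpenOf Y) → DenseSet (↑ Y)
↑-dense Y dense w with dense w
... | p , onW , v , onV , yv with prefixOf-comparable w v p onW onV
...   | inj₁ (s , refl) = s , ↑-incl Y (w ++ s) yv
...   | inj₂ (s , refl) = [] , ↑-upward Y {v} (s , ++-identityʳ (v ++ s)) (↑-incl Y v yv)

shift : Dir → (ℕ → VSet) → ℕ → VSet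
shift d U k = below d (U k)

-- The choice of Z from a family U of sets: a vertex w is chosen iff
-- w ∈ U (c + k), where k is the number of strict prefixes of w already chosen.
chosen : (ℕ → VSet) → ℕ → VSet
chosen U c []      = U c []
chosen U c (d ∷ w) = chosen (shift d U) (indicator (U c []) + c) w

chosen-sound : ∀ U → (∀ k → Upward (U k)) →
  ∀ c w k → k < hits (chosen U c) w → U (c + k) w ≡ true
chosen-sound U up c [] k lt with U c [] in u | k | lt
... | true  | zero  | _     = subst (λ i → U i [] ≡ true) (sym (+-identityʳ c)) u
... | true  | suc _ | s≤s ()
... | false | _     | ()
chosen-sound U up c (d ∷ w) k lt with U c [] in u | k | lt
... | true  | zero  | _ = subst (λ i → U i (d ∷ w) ≡ true) (sym (+-identityʳ c)) (up c (d ∷ w , refl) u)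
... | true  | suc k | s≤s lt' =
  subst (λ i → U i (d ∷ w) ≡ true) (sym (+-suc c k))
    (chosen-sound (shift d U) (λ i → below-upward d (up i)) (suc c) w k lt')
... | false | k     | lt' = chosen-sound (shift d U) (λ i → below-upward d (up i)) c w k lt'

chosen-reaches : ∀ U c v → U c v ≡ true → Σ Word λ v' → v' ≼ v × chosen U c v' ≡ true
chosen-reaches U c []      e = [] , ([] , refl) , e
chosen-reaches U c (d ∷ v) e with U c [] in u
... | true  = [] , (d ∷ v , refl) , u
... | false with chosen-reaches (shift d U) c v e
...   | v' , (s , refl) , z =
  d ∷ v' , (s , refl) , subst (λ b → chosen (shift d U) (indicator b + c) v' ≡ true) (sym u) z

chosen-dense : ∀ U → (∀ k → DenseSet (U k)) → ∀ c → DenseSet (chosen U c)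
chosen-dense U dense c [] =
  let (s , e) = dense c []
      (v' , _ , z) = chosen-reaches U c s e
  in v' , z
chosen-dense U dense c (d ∷ u) =
  chosen-dense (shift d U) (λ k w → dense k (d ∷ w)) (indicator (U c []) + c) u

Comeager-map : ∀ {S S' : Path → Set} → (∀ p → S p → S' p) → Comeager S → Comeager S'
Comeager-map f (O , dense , inAll) = O , dense , λ p onAll → f p (inAll p onAll)

Comeager-cong : ∀ {S S' : Path → Set} → (∀ p → S p ⇔ S' p) → Comeager S ⇔ Comeager S'
Comeager-cong S⇔S' = mk⇔ (Comeager-map λ p → to (S⇔S' p)) (Comeager-map λ p → from (S⇔S' p))

-- (⇒) Z is chosen from the upward closures of the generators of the dense
-- open sets; a path meeting Z infinitely often is then in all of them.
comeager⇒denseWitness : ∀ P → RespectsPointwise P → Comeager (λ p → P (pathSet p)) → DenseWitness P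
comeager⇒denseWitness P respects (O , dense , inAll) =
  Z , chosen-dense U (λ k → ↑-dense (O k) (dense k)) 0 , conclude
  where
  U : ℕ → VSet
  U k = ↑ (O k)
  Z : VSet
  Z = chosen U 0
  conclude : ∀ X → IsPath X → MeetsInfinitelyOften X Z → P X
  conclude X isPath meets = respects (pathSet direction) X pathSet-direction (inAll direction onAll)
    where
    open PathOfSet X isPath
    onAll : ∀ n → OpenOf (O n) direction
    onAll n =
      let (w , xw , lt) = many-hits meets root (suc n)
      in ↑-open (O n) {w} direction (chosen-sound U (λ k → ↑-upward (O k)) 0 w n lt)
                (subst (_≡ true) (sym (pathSet-direction w)) xw)

-- (⇐) The paths with more than n vertices in Z form dense open sets, and a
-- path in all of them meets Z infinitely often.
denseWitness⇒comeager : ∀ P → DenseWitness P → Comeager (λ p → P (pathSet p))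
denseWitness⇒comeager P (Z , dense , holds) =
  O , O-dense , λ p onAll → holds (pathSet p) (pathSet-isPath p) (meets p onAll)
  where
  O : ℕ → VSet
  O n w = n <ᵇ hits Z w
  further : ∀ u → Σ Word λ t → hits Z u < hits Z (u ++ t)
  further u =
    let (s , zs) = dense (u ++ [ L ])
    in L ∷ s , hits-strict Z (L , s , refl) (subst (λ v → Z v ≡ true) (++-assoc u [ L ] s) zs)
  deeper : ∀ n w → Σ Word λ s → n ≤ hits Z (w ++ s)
  deeper zero    w = [] , z≤n
  deeper (suc n) w =
    let (s , n≤) = deeper n w
        (t , lt) = further (w ++ s)
    in s ++ t , subst (λ v → suc n ≤ hits Z v) (++-assoc w s t) (≤-trans (s≤s n≤) lt)
  O-dense : ∀ n → Dense (OpenOf (O n))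
  O-dense n w =
    let (s , lt) = deeper (suc n) w
    in pathThrough (w ++ s) , prefixOf-pathThrough {w} (s , refl) ,
       (w ++ s , prefixOf-pathThrough {w ++ s} ([] , sym (++-identityʳ (w ++ s))) , to T-≡ (<⇒<ᵇ lt))
  -- Compare u with a vertex of p having more Z-prefixes than u.
  meets : ∀ p → (∀ n → OpenOf (O n) p) → MeetsInfinitelyOften (pathSet p) Z
  meets p onAll u onU with onAll (hits Z u)
  ... | w , onW , more with prefixOf-comparable u w p onU onW | <ᵇ⇒< _ _ (from T-≡ more)
  ...   | inj₂ w≼u       | lt = ⊥-elim (<⇒≱ lt (hits-mono Z w≼u))
  ...   | inj₁ (s , refl) | lt =
    let (t , u≺t , t≼w , zt) = hits-increase Z u s lt in t , u≺t , prefixOf-≼ p t≼w onW , zt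

Comeager⇔DenseWitness : ∀ P → RespectsPointwise P → Comeager (λ p → P (pathSet p)) ⇔ DenseWitness P
Comeager⇔DenseWitness P respects = mk⇔ (comeager⇒denseWitness P respects) (denseWitness⇒comeager P)

lift : ∀ {k k'} → (Fin k → Fin k') → Fin (suc k) → Fin (suc k')
lift f zero    = zero
lift f (suc i) = suc (f i)

rename : ∀ {m m' n n'} → (Fin m → Fin m') → (Fin n → Fin n') → Fm m n → Fm m' n'
rename f g (succL x y) = succL (f x) (f y)
rename f g (succR x y) = succR (f x) (f y)
rename f g (mem x X)   = mem (f x) (g X)
rename f g (neg φ)     = neg (rename f g φ)
rename f g (or φ ψ)    = or (rename f g φ) (rename f g ψ)
rename f g (ex₁ φ)     = ex₁ (rename (lift f) g φ)
rename f g (ex₂ φ)     = ex₂ (rename f (lift g) φ)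

Σ-cong-⇔ : {A : Set} {B C : A → Set} → (∀ a → B a ⇔ C a) → Σ A B ⇔ Σ A C
Σ-cong-⇔ B⇔C = mk⇔ (λ (a , b) → a , to (B⇔C a) b) (λ (a , c) → a , from (B⇔C a) c)

rename-sem : ∀ {m m' n n'} (φ : Fm m n) (f : Fin m → Fin m') (g : Fin n → Fin n')
  {ρ σ ρ' σ'} → (∀ i → ρ' (f i) ≡ ρ i) → (∀ j w → σ' (g j) w ≡ σ j w) →
  ⟦ rename f g φ ⟧ ρ' σ' ⇔ ⟦ φ ⟧ ρ σ
rename-sem (succL x y) f g hf hg rewrite hf x | hf y = ⇔-refl
rename-sem (succR x y) f g hf hg rewrite hf x | hf y = ⇔-refl
rename-sem (mem x X) f g {ρ} hf hg rewrite hf x | hg X (ρ x) = ⇔-refl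
rename-sem (neg φ)   f g hf hg = ¬-cong-⇔ (rename-sem φ f g hf hg)
rename-sem (or φ ψ)  f g hf hg = rename-sem φ f g hf hg ⊎-⇔ rename-sem ψ f g hf hg
rename-sem (ex₁ φ)   f g hf hg =
  Σ-cong-⇔ λ w → rename-sem φ (lift f) g (λ { zero → refl ; (suc i) → hf i }) hg
rename-sem (ex₂ φ)   f g hf hg =
  Σ-cong-⇔ λ X → rename-sem φ f (lift g) hf (λ { zero w → refl ; (suc j) w → hg j w })

-- Pointwise equal set valuations give equivalent meanings: both sides are
-- the meaning of the identically renamed formula.
⟦⟧-ext : ∀ {m n} (φ : Fm m n) {ρ σ σ'} → (∀ j w → σ j w ≡ σ' j w) → ⟦ φ ⟧ ρ σ ⇔ ⟦ φ ⟧ ρ σ'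
⟦⟧-ext φ eq = ⇔-trans (⇔-sym (rename-sem φ id id (λ _ → refl) (λ _ _ → refl)))
                      (rename-sem φ id id (λ _ → refl) eq)

⟦⟧-respects : ∀ {m n} (ψ : Fm m (suc n)) ρ σ → RespectsPointwise (λ X → ⟦ ψ ⟧ ρ (X ∷ᵛ σ))
⟦⟧-respects ψ ρ σ X X' eq = to (⟦⟧-ext ψ λ { zero w → eq w ; (suc j) w → refl })

-- Makes room for a new set variable at position 1.
insert₁ : ∀ {n} → Fin (suc n) → Fin (suc (suc n))
insert₁ zero    = zero
insert₁ (suc j) = suc (suc j)

infixr 6 _∧ᶠ_
infixr 5 _⇒ᶠ_

_∧ᶠ_ : ∀ {m n} → Fm m n → Fm m n → Fm m n
A ∧ᶠ B = neg (or (neg A) (neg B))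

_⇒ᶠ_ : ∀ {m n} → Fm m n → Fm m n → Fm m n
A ⇒ᶠ B = or (neg A) B

∀₁ᶠ : ∀ {m n} → Fm (suc m) n → Fm m n
∀₁ᶠ φ = neg (ex₁ (neg φ))

∀₂ᶠ : ∀ {m n} → Fm m (suc n) → Fm m n
∀₂ᶠ φ = neg (ex₂ (neg φ))

Childᶠ : ∀ {m n} → Fin m → Fin m → Fm m n
Childᶠ x y = or (succL x y) (succR x y)

-- In the formulas below the set variable 0 is the set being described and
-- first-order variables are numbered from the innermost quantifier.

-- ∀a b. a ∈ Y ∧ child(a, b) → b ∈ Y
ChildClosedᶠ : ∀ {m n} → Fm m (suc n)
ChildClosedᶠ = ∀₁ᶠ (∀₁ᶠ (mem (suc zero) zero ∧ᶠ Childᶠ (suc zero) zero ⇒ᶠ mem zero zero))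

-- ∀Y. x ∈ Y ∧ Y child-closed → y ∈ Y
Prefixᶠ : ∀ {m n} → Fin m → Fin m → Fm m n
Prefixᶠ x y = ∀₂ᶠ (mem x zero ∧ᶠ ChildClosedᶠ ⇒ᶠ mem y zero)

-- ∀u ∃v. u ≼ v ∧ v ∈ Z
DenseSetᶠ : ∀ {m n} → Fm m (suc n)
DenseSetᶠ = ∀₁ᶠ (ex₁ (Prefixᶠ (suc zero) zero ∧ᶠ mem zero zero))

-- ∀a b. child(a, b) ∧ b ∈ X → a ∈ X
ParentClosedᶠ : ∀ {m n} → Fm m (suc n)
ParentClosedᶠ = ∀₁ᶠ (∀₁ᶠ (Childᶠ (suc zero) zero ∧ᶠ mem zero zero ⇒ᶠ mem (suc zero) zero))

-- ∀x yL yR. x ∈ X ∧ yL = xL ∧ yR = xR → exactly one of yL, yR is in X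
OneChildᶠ : ∀ {m n} → Fm m (suc n)
OneChildᶠ = ∀₁ᶠ (∀₁ᶠ (∀₁ᶠ
  (mem (suc (suc zero)) zero ∧ᶠ succL (suc (suc zero)) (suc zero) ∧ᶠ succR (suc (suc zero)) zero ⇒ᶠ
   or (mem (suc zero) zero ∧ᶠ neg (mem zero zero)) (neg (mem (suc zero) zero) ∧ᶠ mem zero zero))))

IsPathᶠ : ∀ {m n} → Fm m (suc n)
IsPathᶠ = ex₁ (mem zero zero) ∧ᶠ ParentClosedᶠ ∧ᶠ OneChildᶠ

-- With X = 0 and Z = 1:  ∀u. u ∈ X → ∃v. v ∈ X ∧ v ∈ Z ∧ ∃y. child(u, y) ∧ y ≼ v
MeetsInfinitelyOftenᶠ : ∀ {m n} → Fm m (suc (suc n))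
MeetsInfinitelyOftenᶠ = ∀₁ᶠ (mem zero zero ⇒ᶠ ex₁ (mem zero zero ∧ᶠ mem zero (suc zero) ∧ᶠ
  ex₁ (Childᶠ (suc (suc zero)) zero ∧ᶠ Prefixᶠ zero (suc zero))))

-- The S2S replacement of ∀*_π X. ψ:  ∃Z. dense(Z) ∧ ∀X. path(X) ∧ meets(X, Z) → ψ
DenseWitnessᶠ : ∀ {m n} → Fm m (suc n) → Fm m n
DenseWitnessᶠ ψ = ex₂ (DenseSetᶠ ∧ᶠ ∀₂ᶠ (IsPathᶠ ∧ᶠ MeetsInfinitelyOftenᶠ ⇒ᶠ rename id insert₁ ψ))

translate : ∀ {m n} → Fm⁺ m n → Fm m n
translate (succL x y) = succL x y
translate (succR x y) = succR x y
translate (mem x X)   = mem x X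
translate (neg φ)     = neg (translate φ)
translate (or φ ψ)    = or (translate φ) (translate ψ)
translate (ex₁ φ)     = ex₁ (translate φ)
translate (ex₂ φ)     = ex₂ (translate φ)
translate (allπ φ)    = DenseWitnessᶠ (translate φ)

-- Meaning of the gadget formulas.  The derived connectives ∧, → and ∀ only
-- have their intended meaning classically.

module Classical (em : ExcludedMiddle 0ℓ) where

  and-classical : {A B : Set} → (¬ (¬ A ⊎ ¬ B)) ⇔ (A × B)
  and-classical = mk⇔ (λ h → em⇒dne em (λ ¬a → h (inj₁ ¬a)) , em⇒dne em (λ ¬b → h (inj₂ ¬b)))
                      (λ { (a , _) (inj₁ ¬a) → ¬a a ; (_ , b) (inj₂ ¬b) → ¬b b })

  implies-classical : {A B : Set} → (¬ A ⊎ B) ⇔ (A → B)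
  implies-classical {A} {B} = mk⇔ apply decide
    where
    apply : ¬ A ⊎ B → A → B
    apply (inj₁ ¬a) a = ⊥-elim (¬a a)
    apply (inj₂ b)  _ = b
    decide : (A → B) → ¬ A ⊎ B
    decide f with em {A}
    ... | yes a = inj₂ (f a)
    ... | no ¬a = inj₁ ¬a

  forall-classical : {W : Set} {P : W → Set} → (¬ Σ W (λ w → ¬ P w)) ⇔ ((w : W) → P w)
  forall-classical = mk⇔ (λ h w → em⇒dne em (λ ¬p → h (w , ¬p))) (λ f (w , ¬p) → ¬p (f w))

  ChildClosedᶠ-sem : ∀ {m n} (ρ : Fin m → Word) (σ : Fin n → VSet) Y →
    ⟦ ChildClosedᶠ ⟧ ρ (Y ∷ᵛ σ) ⇔ ChildClosed Y
  ChildClosedᶠ-sem ρ σ Y = mk⇔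
    (λ h a d ya → to implies-classical (to forall-classical (to forall-classical h a) (a ++ [ d ]))
                    (from and-classical (ya , from (child⇔ a _) (d , refl))))
    (λ closed → from forall-classical λ a → from forall-classical λ b → from implies-classical λ h →
       let (ya , a→b) = to and-classical h in step closed ya (to (child⇔ a b) a→b))
    where
    step : ∀ {a b} → ChildClosed Y → Y a ≡ true → Child a b → Y b ≡ true
    step closed ya (d , refl) = closed _ d ya

  Prefixᶠ-sem : ∀ {m n} (x y : Fin m) (ρ : Fin m → Word) (σ : Fin n → VSet) →
    ⟦ Prefixᶠ x y ⟧ ρ σ ⇔ (ρ x ≼ ρ y)
  Prefixᶠ-sem x y ρ σ = mk⇔
    (λ h → to (≼⇔closure (ρ x) (ρ y)) λ Y yx closed →
       to implies-classical (to forall-classical h Y)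
         (from and-classical (yx , from (ChildClosedᶠ-sem ρ σ Y) closed)))
    (λ x≼y → from forall-classical λ Y → from implies-classical λ h →
       let (yx , closed) = to and-classical h
       in from (≼⇔closure (ρ x) (ρ y)) x≼y Y yx (to (ChildClosedᶠ-sem ρ σ Y) closed))

  DenseSetᶠ-sem : ∀ {m n} (ρ : Fin m → Word) (σ : Fin n → VSet) Z → ⟦ DenseSetᶠ ⟧ ρ (Z ∷ᵛ σ) ⇔ DenseSet Z
  DenseSetᶠ-sem ρ σ Z = mk⇔
    (λ (h : ⟦ DenseSetᶠ ⟧ ρ (Z ∷ᵛ σ)) u →
       let (v , hv) = to forall-classical h u
           (u≼v , zv) = to and-classical hv
           (s , v≡) = to (Prefixᶠ-sem (suc zero) zero (v ∷ᵛ (u ∷ᵛ ρ)) (Z ∷ᵛ σ)) u≼v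
       in s , subst (λ w → Z w ≡ true) v≡ zv)
    (λ dense → from forall-classical λ u →
       let (s , zs) = dense u
       in u ++ s , from and-classical
            (from (Prefixᶠ-sem (suc zero) zero ((u ++ s) ∷ᵛ (u ∷ᵛ ρ)) (Z ∷ᵛ σ)) (s , refl) , zs))

  ParentClosedᶠ-sem : ∀ {m n} (ρ : Fin m → Word) (σ : Fin n → VSet) X →
    ⟦ ParentClosedᶠ ⟧ ρ (X ∷ᵛ σ) ⇔ ParentClosed X
  ParentClosedᶠ-sem ρ σ X = mk⇔
    (λ h a d xc → to implies-classical (to forall-classical (to forall-classical h a) (a ++ [ d ]))
                    (from and-classical (from (child⇔ a _) (d , refl) , xc)))
    (λ closed → from forall-classical λ a → from forall-classical λ b → from implies-classical λ h →
       let (a→b , xb) = to and-classical h in step closed (to (child⇔ a b) a→b) xb)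
    where
    step : ∀ {a b} → ParentClosed X → Child a b → X b ≡ true → X a ≡ true
    step closed (d , refl) xb = closed _ d xb

  OneChildᶠ-sem : ∀ {m n} (ρ : Fin m → Word) (σ : Fin n → VSet) X → ⟦ OneChildᶠ ⟧ ρ (X ∷ᵛ σ) ⇔ OneChild X
  OneChildᶠ-sem ρ σ X = mk⇔
    (λ h x xx → to (and-classical ⊎-⇔ and-classical)
       (to implies-classical
          (to forall-classical (to forall-classical (to forall-classical h x) (x ++ [ L ])) (x ++ [ R ]))
          (from and-classical (xx , from and-classical (refl , refl)))))
    (λ oneChild → from forall-classical λ x → from forall-classical λ yL → from forall-classical λ yR →
       from implies-classical λ h →
         let (xx , children) = to and-classical h
             (yL≡ , yR≡) = to and-classical children
         in from (and-classical ⊎-⇔ and-classical) (step oneChild xx yL≡ yR≡))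
    where
    step : ∀ {x yL yR} → OneChild X → X x ≡ true → yL ≡ x ++ [ L ] → yR ≡ x ++ [ R ] →
      (X yL ≡ true × ¬ X yR ≡ true) ⊎ (¬ X yL ≡ true × X yR ≡ true)
    step oneChild xx refl refl = oneChild _ xx

  IsPathᶠ-sem : ∀ {m n} (ρ : Fin m → Word) (σ : Fin n → VSet) X → ⟦ IsPathᶠ ⟧ ρ (X ∷ᵛ σ) ⇔ IsPath X
  IsPathᶠ-sem ρ σ X = mk⇔
    (λ h → let (nonempty , rest) = to and-classical h
               (parent , child) = to and-classical rest
           in record { nonempty     = nonempty
                     ; parentClosed = to (ParentClosedᶠ-sem ρ σ X) parent
                     ; oneChild     = to (OneChildᶠ-sem ρ σ X) child })
    (λ isPath → let open IsPath isPath in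
       from and-classical (nonempty , from and-classical
         (from (ParentClosedᶠ-sem ρ σ X) parentClosed , from (OneChildᶠ-sem ρ σ X) oneChild)))

  MeetsInfinitelyOftenᶠ-sem : ∀ {m n} (ρ : Fin m → Word) (σ : Fin n → VSet) X Z →
    ⟦ MeetsInfinitelyOftenᶠ ⟧ ρ (X ∷ᵛ (Z ∷ᵛ σ)) ⇔ MeetsInfinitelyOften X Z
  MeetsInfinitelyOftenᶠ-sem ρ σ X Z = mk⇔
    (λ (h : ⟦ MeetsInfinitelyOftenᶠ ⟧ ρ (X ∷ᵛ (Z ∷ᵛ σ))) u xu →
       let (v , hv) = to implies-classical (to forall-classical h u) xu
           (xv , rest) = to and-classical hv
           (zv , (y , hy)) = to and-classical rest
           (u→y , y≼v) = to and-classical hy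
       in v , to (child-then-prefix⇔≺ u v)
                (y , to (child⇔ u y) u→y , to (prefix y v u) y≼v) , xv , zv)
    (λ meets → from forall-classical λ u → from implies-classical λ xu →
       let (v , u≺v , xv , zv) = meets u xu
           (y , u→y , y≼v) = from (child-then-prefix⇔≺ u v) u≺v
       in v , from and-classical (xv , from and-classical (zv ,
            (y , from and-classical (from (child⇔ u y) u→y , from (prefix y v u) y≼v)))))
    where
    prefix : ∀ y v u → ⟦ Prefixᶠ zero (suc zero) ⟧ (y ∷ᵛ (v ∷ᵛ (u ∷ᵛ ρ))) (X ∷ᵛ (Z ∷ᵛ σ)) ⇔ (y ≼ v)
    prefix y v u = Prefixᶠ-sem zero (suc zero) (y ∷ᵛ (v ∷ᵛ (u ∷ᵛ ρ))) (X ∷ᵛ (Z ∷ᵛ σ))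

  DenseWitnessᶠ-sem : ∀ {m n} (ψ : Fm m (suc n)) (ρ : Fin m → Word) (σ : Fin n → VSet) →
    ⟦ DenseWitnessᶠ ψ ⟧ ρ σ ⇔ DenseWitness (λ X → ⟦ ψ ⟧ ρ (X ∷ᵛ σ))
  DenseWitnessᶠ-sem ψ ρ σ = mk⇔
    (λ (Z , h) → let (dense , holds) = to and-classical h in
       Z , to (DenseSetᶠ-sem ρ σ Z) dense , λ X isPath meets →
         to (weakened X Z) (to implies-classical (to forall-classical holds X)
           (from and-classical (from (IsPathᶠ-sem ρ (Z ∷ᵛ σ) X) isPath ,
                                from (MeetsInfinitelyOftenᶠ-sem ρ σ X Z) meets))))
    (λ (Z , dense , holds) → Z , from and-classical (from (DenseSetᶠ-sem ρ σ Z) dense ,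
       from forall-classical λ X → from implies-classical λ h →
         let (isPath , meets) = to and-classical h
         in from (weakened X Z) (holds X (to (IsPathᶠ-sem ρ (Z ∷ᵛ σ) X) isPath)
                                         (to (MeetsInfinitelyOftenᶠ-sem ρ σ X Z) meets))))
    where
    weakened : ∀ X Z → ⟦ rename id insert₁ ψ ⟧ ρ (X ∷ᵛ (Z ∷ᵛ σ)) ⇔ ⟦ ψ ⟧ ρ (X ∷ᵛ σ)
    weakened X Z = rename-sem ψ id insert₁ (λ _ → refl) λ { zero w → refl ; (suc j) w → refl }

  translate-sound : ∀ {m n} (φ : Fm⁺ m n) ρ σ → ⟦ φ ⟧⁺ ρ σ ⇔ ⟦ translate φ ⟧ ρ σ
  translate-sound (succL x y) ρ σ = ⇔-refl
  translate-sound (succR x y) ρ σ = ⇔-refl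
  translate-sound (mem x X)   ρ σ = ⇔-refl
  translate-sound (neg φ)     ρ σ = ¬-cong-⇔ (translate-sound φ ρ σ)
  translate-sound (or φ ψ)    ρ σ = translate-sound φ ρ σ ⊎-⇔ translate-sound ψ ρ σ
  translate-sound (ex₁ φ)     ρ σ = Σ-cong-⇔ λ w → translate-sound φ (w ∷ᵛ ρ) σ
  translate-sound (ex₂ φ)     ρ σ = Σ-cong-⇔ λ X → translate-sound φ ρ (X ∷ᵛ σ)
  translate-sound (allπ φ)    ρ σ =
    ⇔-trans (Comeager-cong λ p → translate-sound φ ρ (pathSet p ∷ᵛ σ))
   (⇔-trans (Comeager⇔DenseWitness _ (⟦⟧-respects (translate φ) ρ σ))
            (⇔-sym (DenseWitnessᶠ-sem (translate φ) ρ σ)))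

theorem8p2 : Σ ((n : ℕ) → Fm⁺ zero n → Fm zero n) (λ tr →
               ExcludedMiddle 0ℓ → (n : ℕ) (φ : Fm⁺ zero n) → Equivalent φ (tr n φ))
theorem8p2 = (λ n → translate) , λ em n φ σ → Classical.translate-sound em φ noFO σ
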